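{- If the string $s$ is a Lyndon word, then the starting positions listed in the Lyndon suffix array of $s$ are strictly increasing.
   Context: Strings are compared lexicographically (a proper prefix is smaller). A Lyndon word is a nonempty string strictly lexicographically smaller than each of its nonempty proper suffixes. The Lyndon suffix array of a string $s=s[1..n]$ is the list of starting positions $i$ of those suffixes $s[i..n]$ which are Lyndon words, ordered by increasing lexicographic order of the suffixes. -}

module Defs where

open import Level using (Level)
open import Data.Nat using (ℕ; zero; suc; _∸_; _≤_; _<_)
open import Data.List using (List; []; _∷_; length; drop)
open import Data.List.Membership.Propositional using (_∈_)
open import Data.List.Relation.Unary.Linked using (Linked)
open import Data.List.Relation.Unary.Unique.Propositional using (Unique)
open import Data.Product using (_×_)
open import Data.Sum using (_⊎_)
open import Relation.Binary.PropositionalEquality using (_≡_)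
open import Relation.Binary.Bundles using (StrictTotalOrder)

StrictlyIncreasing : List ℕ → Set
StrictlyIncreasing = Linked _<_

module _ {a ℓ₁ ℓ₂ : Level} (Σ : StrictTotalOrder a ℓ₁ ℓ₂) where
  open StrictTotalOrder Σ renaming (Carrier to Char; _<_ to _<c_)

  data _<lex_ : List Char → List Char → Set (a Level.⊔ ℓ₁ Level.⊔ ℓ₂) where
    []<∷  : ∀ {y ys} → [] <lex (y ∷ ys)
    head< : ∀ {x y xs ys} → x <c y → (x ∷ xs) <lex (y ∷ ys)
    tail< : ∀ {x xs ys} → xs <lex ys → (x ∷ xs) <lex (x ∷ ys)

  -- Suffix of s starting at the 1-based position i, i.e. s[i..n].
  suffix : List Char → ℕ → List Char
  suffix s i = drop (i ∸ 1) s

  Position : List Char → ℕ → Set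
  Position s i = 1 ≤ i × i ≤ length s

  IsLyndon : List Char → Set (a Level.⊔ ℓ₁ Level.⊔ ℓ₂)
  IsLyndon w = (0 < length w) × (∀ k → 1 ≤ k → k < length w → w <lex drop k w)

  IsLyndonSuffixArray : List Char → List ℕ → Set (a Level.⊔ ℓ₁ Level.⊔ ℓ₂)
  IsLyndonSuffixArray s L =
    (∀ i → i ∈ L → Position s i × IsLyndon (suffix s i)) ×
    (∀ i → Position s i → IsLyndon (suffix s i) → i ∈ L) ×
    Unique L ×
    Linked (λ i j → suffix s i <lex suffix s j) L

module Submission where

-- If the suffix s[j..n] is a Lyndon word and j < i ≤ n, then
-- s[i..n] is a nonempty proper suffix of s[j..n], hence s[j..n] <lex s[i..n].
-- Since <lex is asymmetric, s[i..n] <lex s[j..n] with s[j..n] Lyndon forces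
-- i < j.  Neighbouring entries of a Lyndon suffix array satisfy exactly this
-- hypothesis (both are positions with Lyndon suffixes, ordered by <lex), so the
-- array is strictly increasing.

open import Defs
open import Level using (Level)
open import Data.Nat using (ℕ; zero; suc; _<_; z≤n; s≤s)
open import Data.Nat.Properties using (<-cmp)
open import Data.List using (List; []; _∷_; drop; length)
open import Data.List.Membership.Propositional using (_∈_)
open import Data.List.Relation.Unary.All as All using (All; []; _∷_)
open import Data.List.Relation.Unary.Linked using (Linked; []; [-]; _∷_)
open import Data.Product using (_,_; _×_)
open import Data.Empty using (⊥; ⊥-elim)
open import Relation.Binary.PropositionalEquality using (refl)
open import Relation.Binary.Bundles using (StrictTotalOrder)
open import Relation.Binary.Definitions using (tri<; tri≈; tri>)

Linked-map-All : ∀ {a p r s} {A : Set a} {P : A → Set p}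
                 {R : A → A → Set r} {S : A → A → Set s} →
                 (∀ {x y} → P x → P y → R x y → S x y) →
                 ∀ {xs} → All P xs → Linked R xs → Linked S xs
Linked-map-All f _                  []         = []
Linked-map-All f _                  [-]        = [-]
Linked-map-All f (px ∷ pxs@(py ∷ _)) (r ∷ rs) = f px py r ∷ Linked-map-All f pxs rs

module _ {a ℓ₁ ℓ₂ : Level} (Σ : StrictTotalOrder a ℓ₁ ℓ₂) where
  open StrictTotalOrder Σ using (asym; irrefl; module Eq) renaming (Carrier to Char)

  _≺_ : List Char → List Char → Set _
  _≺_ = _<lex_ Σ

  lex-asym : ∀ {u v} → u ≺ v → v ≺ u → ⊥
  lex-asym []<∷       ()
  lex-asym (head< p) (head< q) = asym p q
  lex-asym (head< p) (tail< _) = irrefl Eq.refl p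
  lex-asym (tail< _) (head< q) = irrefl Eq.refl q
  lex-asym (tail< p) (tail< q) = lex-asym p q

  -- If the suffix of t from (0-based) offset j is Lyndon, it is smaller than
  -- every later nonempty suffix: the latter is a proper suffix of it.
  lyndon-below-later-suffix : ∀ (t : List Char) j i → j < i → i < length t →
                              IsLyndon Σ (drop j t) → drop j t ≺ drop i t
  lyndon-below-later-suffix (_ ∷ _) zero    (suc i) _         i<n       (_ , below) =
    below (suc i) (s≤s z≤n) i<n
  lyndon-below-later-suffix (_ ∷ t) (suc j) (suc i) (s≤s j<i) (s≤s i<n) lyndon =
    lyndon-below-later-suffix t j i j<i i<n lyndon

  lex-order⇒position-order : ∀ s i j → Position Σ s i → Position Σ s j →
                             IsLyndon Σ (suffix Σ s j) →
                             suffix Σ s i ≺ suffix Σ s j → i < j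
  lex-order⇒position-order s (suc i) (suc j) (_ , i≤n) _ lyndon lt with <-cmp i j
  ... | tri< i<j _ _ = s≤s i<j
  ... | tri≈ _ refl _ = ⊥-elim (lex-asym lt lt)
  ... | tri> _ _ j<i = ⊥-elim (lex-asym lt (lyndon-below-later-suffix s j i j<i i≤n lyndon))

fact4 : ∀ {a ℓ₁ ℓ₂ : Level} (Σ : StrictTotalOrder a ℓ₁ ℓ₂)
    (s : List (StrictTotalOrder.Carrier Σ)) (L : List ℕ) →
    IsLyndon Σ s → IsLyndonSuffixArray Σ s L → StrictlyIncreasing L
fact4 Σ s L _ (members , _ , _ , sorted) =
  Linked-map-All step (All.tabulate (λ {i} i∈L → members i i∈L)) sorted
  where
  step : ∀ {i j} → Position Σ s i × IsLyndon Σ (suffix Σ s i) →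
         Position Σ s j × IsLyndon Σ (suffix Σ s j) →
         _<lex_ Σ (suffix Σ s i) (suffix Σ s j) → i < j
  step (pos-i , _) (pos-j , lyndon-j) = lex-order⇒position-order Σ s _ _ pos-i pos-j lyndon-j
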